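{- Let $A$ be a dendriform algebra, $n\ge 1$, $a_1,\ldots,a_n\in A$, and let $\omega=(n\,\cdots\,2\,1)\in S_n$ be the order-reversing permutation $\omega(i)=n+1-i$. Then for every $\sigma\in S_n$, $$U_\sigma(a_1,\ldots,a_n)=(-1)^{n-1}\,T^{\succeq}_{\omega\sigma\omega}(a_n,\ldots,a_1).$$
   Context: A dendriform algebra is a vector space $A$ with bilinear operations $\prec,\succ$ satisfying $(a\prec b)\prec c=a\prec(b*c)$, $(a\succ b)\prec c=a\succ(b\prec c)$, $a\succ(b\succ c)=(a*b)\succ c$, where $a*b:=a\prec b+a\succ b$. Put $a\rhd b:=a\succ b-b\prec a$, $a\lhd b:=a\prec b-b\succ a$, $\ell^{(m)}(b_1,\ldots,b_m):=(\cdots((b_1\rhd b_2)\rhd b_3)\cdots)\rhd b_m$, $r^{(m)}(b_1,\ldots,b_m):=b_1\lhd(b_2\lhd(\cdots(b_{m-1}\lhd b_m)\cdots))$, $\ell^{(1)}(b)=r^{(1)}(b)=b$. Write $\sigma_i=\sigma(i)$. For $\sigma\in S_n$: $F_\sigma$ is the set of $l\in\{1,\ldots,n-1\}$ with $\sigma_l<\sigma_j$ for all $j\ge l+1$, written $\{l_1<\cdots<l_q\}$, $l_0:=0$, $l_{q+1}:=n$, and $U_\sigma(a_1,\ldots,a_n):=r^{(l_1-l_0)}(a_{\sigma_{l_0+1}},\ldots,a_{\sigma_{l_1}})*\cdots*r^{(l_{q+1}-l_q)}(a_{\sigma_{l_q+1}},\ldots,a_{\sigma_n})$. The alternative dendriform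 structure on $A$ is $a\preceq b:=-b\succ a$, $a\succeq b:=-b\prec a$; its associative product is $a\circledast b:=-b*a$ and its operation $a\succeq b-b\preceq a$ equals $a\rhd b$. For $\tau\in S_n$, $E_\tau$ is the set of $k\in\{1,\ldots,n-1\}$ with $\tau_{k+1}>\tau_j$ for all $j\le k$, written $\{k_1<\cdots<k_p\}$, $k_0:=0$, $k_{p+1}:=n$, and $T^{\succeq}_\tau(b_1,\ldots,b_n):=\ell^{(k_1-k_0)}(b_{\tau_{k_0+1}},\ldots,b_{\tau_{k_1}})\circledast\cdots\circledast\ell^{(k_{p+1}-k_p)}(b_{\tau_{k_p+1}},\ldots,b_{\tau_n})$. -}

module Defs where

open import Level using (_⊔_) renaming (suc to lsuc)
open import Data.Nat using (ℕ; zero; suc)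
open import Data.Product using (Σ)
open import Data.Fin using (Fin; toℕ; opposite) renaming (_<_ to _<ᶠ_; _≤_ to _≤ᶠ_)
open import Data.Fin.Properties using (all?) renaming (_<?_ to _<ᶠ?_; _≤?_ to _≤ᶠ?_)
import Data.Nat.Properties as ℕP
open import Data.Fin.Permutation using (Permutation′; _⟨$⟩ʳ_; _∘ₚ_; reverse)
open import Data.List using (List; []; _∷_; map; foldl; allFin)
open import Data.Bool using (true; false; if_then_else_)
open import Relation.Binary.PropositionalEquality using (_≡_)
open import Relation.Nullary using (¬_; Dec; does)
open import Relation.Nullary.Decidable using (_→-dec_)
open import Relation.Unary using (Pred; Decidable)
open import Algebra.Bundles using (CommutativeRing)
open import Algebra.Module.Bundles using (Module)

record IsField {r ℓr} (R : CommutativeRing r ℓr) : Set (r ⊔ ℓr) where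
  open CommutativeRing R
  field
    nontrivial : ¬ (1# ≈ 0#)
    inverse    : ∀ x → ¬ (x ≈ 0#) → Σ Carrier (λ y → (x * y) ≈ 1#)

record Dendriform {r ℓr m ℓm} (R : CommutativeRing r ℓr) (M : Module R m ℓm)
       : Set (r ⊔ ℓr ⊔ m ⊔ ℓm) where
  open CommutativeRing R using () renaming (Carrier to K)
  open Module M
  infixl 7 _≺_ _≻_ _⋆_
  field
    _≺_ : Carrierᴹ → Carrierᴹ → Carrierᴹ
    _≻_ : Carrierᴹ → Carrierᴹ → Carrierᴹ
  _⋆_ : Carrierᴹ → Carrierᴹ → Carrierᴹ
  a ⋆ b = (a ≺ b) +ᴹ (a ≻ b)
  field
    ≺-cong  : ∀ {a a′ b b′} → a ≈ᴹ a′ → b ≈ᴹ b′ → (a ≺ b) ≈ᴹ (a′ ≺ b′)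
    ≻-cong  : ∀ {a a′ b b′} → a ≈ᴹ a′ → b ≈ᴹ b′ → (a ≻ b) ≈ᴹ (a′ ≻ b′)
    ≺-+ˡ    : ∀ a a′ b → ((a +ᴹ a′) ≺ b) ≈ᴹ ((a ≺ b) +ᴹ (a′ ≺ b))
    ≺-+ʳ    : ∀ a b b′ → (a ≺ (b +ᴹ b′)) ≈ᴹ ((a ≺ b) +ᴹ (a ≺ b′))
    ≻-+ˡ    : ∀ a a′ b → ((a +ᴹ a′) ≻ b) ≈ᴹ ((a ≻ b) +ᴹ (a′ ≻ b))
    ≻-+ʳ    : ∀ a b b′ → (a ≻ (b +ᴹ b′)) ≈ᴹ ((a ≻ b) +ᴹ (a ≻ b′))
    ≺-*ˡ    : ∀ (c : K) a b → ((c *ₗ a) ≺ b) ≈ᴹ (c *ₗ (a ≺ b))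
    ≺-*ʳ    : ∀ (c : K) a b → (a ≺ (c *ₗ b)) ≈ᴹ (c *ₗ (a ≺ b))
    ≻-*ˡ    : ∀ (c : K) a b → ((c *ₗ a) ≻ b) ≈ᴹ (c *ₗ (a ≻ b))
    ≻-*ʳ    : ∀ (c : K) a b → (a ≻ (c *ₗ b)) ≈ᴹ (c *ₗ (a ≻ b))
    dend₁ : ∀ a b c → ((a ≺ b) ≺ c) ≈ᴹ (a ≺ (b ⋆ c))
    dend₂ : ∀ a b c → ((a ≻ b) ≺ c) ≈ᴹ (a ≻ (b ≺ c))
    dend₃ : ∀ a b c → (a ≻ (b ≻ c)) ≈ᴹ ((a ⋆ b) ≻ c)

  _▷_ : Carrierᴹ → Carrierᴹ → Carrierᴹ
  a ▷ b = (a ≻ b) +ᴹ (-ᴹ (b ≺ a))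
  _◁_ : Carrierᴹ → Carrierᴹ → Carrierᴹ
  a ◁ b = (a ≺ b) +ᴹ (-ᴹ (b ≻ a))

  -- alternative dendriform structure: a ⪯ b = − b ≻ a, a ⪰ b = − b ≺ a;
  -- its associative product a ⊛ b = a ⪯ b + a ⪰ b = −(b * a).
  _⪯_ : Carrierᴹ → Carrierᴹ → Carrierᴹ
  a ⪯ b = -ᴹ (b ≻ a)
  _⪰_ : Carrierᴹ → Carrierᴹ → Carrierᴹ
  a ⪰ b = -ᴹ (b ≺ a)
  _⊛_ : Carrierᴹ → Carrierᴹ → Carrierᴹ
  a ⊛ b = -ᴹ (b ⋆ a)

  -- ℓ^(m)(b₁,…,b_m) = (⋯((b₁ ▷ b₂) ▷ b₃)⋯) ▷ b_m   (only used for m ≥ 1)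
  ℓ⁽⁾ : List Carrierᴹ → Carrierᴹ
  ℓ⁽⁾ []       = 0ᴹ
  ℓ⁽⁾ (x ∷ xs) = foldl _▷_ x xs

  -- r^(m)(b₁,…,b_m) = b₁ ◁ (b₂ ◁ (⋯(b_{m-1} ◁ b_m)⋯))   (only used for m ≥ 1)
  r⁽⁾ : List Carrierᴹ → Carrierᴹ
  r⁽⁾ []           = 0ᴹ
  r⁽⁾ (x ∷ [])     = x
  r⁽⁾ (x ∷ y ∷ xs) = x ◁ r⁽⁾ (y ∷ xs)

  prod : (Carrierᴹ → Carrierᴹ → Carrierᴹ) → List Carrierᴹ → Carrierᴹ
  prod _∙_ []           = 0ᴹ
  prod _∙_ (x ∷ [])     = x
  prod _∙_ (x ∷ y ∷ xs) = x ∙ prod _∙_ (y ∷ xs)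

consHead : ∀ {a} {A : Set a} → A → List (List A) → List (List A)
consHead x []       = (x ∷ []) ∷ []
consHead x (b ∷ bs) = (x ∷ b) ∷ bs

splitAfter : ∀ {a p} {A : Set a} {P : Pred A p} → Decidable P → List A → List (List A)
splitAfter {A = A} P? []       = []
splitAfter {A = A} P? (x ∷ xs) = go x xs
  where
  go : A → List A → List (List A)
  go x []       = (x ∷ []) ∷ []
  go x (y ∷ ys) = if does (P? x) then (x ∷ []) ∷ go y ys else consHead x (go y ys)

-- Positions are 0-based: position p : Fin n corresponds to index p+1.
-- A cut after position p (with p+1 < n) corresponds to l = p+1 ∈ F_σ
-- (resp. k = p+1 ∈ E_τ).

-- l = p+1 ∈ F_σ  ⇔  σ_l < σ_j for all j ≥ l+1
FCut : ∀ {n} → Permutation′ n → Pred (Fin n) _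
FCut σ p = ∀ q → p <ᶠ q → (σ ⟨$⟩ʳ p) <ᶠ (σ ⟨$⟩ʳ q)

FCut? : ∀ {n} (σ : Permutation′ n) → Decidable (FCut σ)
FCut? σ p = all? (λ q → (p <ᶠ? q) →-dec ((σ ⟨$⟩ʳ p) <ᶠ? (σ ⟨$⟩ʳ q)))

-- k = p+1 ∈ E_τ  ⇔  τ_{k+1} > τ_j for all j ≤ k
ECut : ∀ {n} → Permutation′ n → Pred (Fin n) _
ECut τ p = ∀ q → toℕ q ≡ suc (toℕ p) → ∀ j → j ≤ᶠ p → (τ ⟨$⟩ʳ j) <ᶠ (τ ⟨$⟩ʳ q)

ECut? : ∀ {n} (τ : Permutation′ n) → Decidable (ECut τ)
ECut? τ p = all? (λ q → (toℕ q ℕP.≟ suc (toℕ p)) →-dec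
                   all? (λ j → (j ≤ᶠ? p) →-dec ((τ ⟨$⟩ʳ j) <ᶠ? (τ ⟨$⟩ʳ q))))

ω : ∀ {n} → Permutation′ n
ω = reverse

module _ {r ℓr m ℓm} {R : CommutativeRing r ℓr} {M : Module R m ℓm}
         (D : Dendriform R M) where
  open Module M using (Carrierᴹ)
  open Dendriform D

  -- U_σ(a₁,…,a_n) = r(a_{σ₁},…,a_{σ_{l₁}}) * ⋯ * r(a_{σ_{l_q+1}},…,a_{σ_n})
  U : ∀ {n} → Permutation′ n → (Fin n → Carrierᴹ) → Carrierᴹ
  U {n} σ a = prod _⋆_ (map (λ blk → r⁽⁾ (map (λ p → a (σ ⟨$⟩ʳ p)) blk))
                            (splitAfter (FCut? σ) (allFin n)))

  -- T^⪰_τ(b₁,…,b_n) = ℓ(b_{τ₁},…,b_{τ_{k₁}}) ⊛ ⋯ ⊛ ℓ(b_{τ_{k_p+1}},…,b_{τ_n})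
  T⪰ : ∀ {n} → Permutation′ n → (Fin n → Carrierᴹ) → Carrierᴹ
  T⪰ {n} τ b = prod _⊛_ (map (λ blk → ℓ⁽⁾ (map (λ p → b (τ ⟨$⟩ʳ p)) blk))
                             (splitAfter (ECut? τ) (allFin n)))

minusOne^ : ∀ {r ℓr} (R : CommutativeRing r ℓr) → ℕ → CommutativeRing.Carrier R
minusOne^ R k = (- 1#) ^ k
  where
  open CommutativeRing R using (-_; 1#; semiring)
  open import Algebra.Bundles using (Semiring)
  open import Algebra.Definitions.RawSemiring (Semiring.rawSemiring semiring) using (_^_)

-- Read the word backwards. Since a ◁ b = −(b ▷ a), a block r(b₁,…,b_m) equals
-- (−1)^(m−1) ℓ(b_m,…,b₁); since a * b = −(b ⊛ a) and ⊛ is associative, a *-product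
-- of q factors is (−1)^(q−1) times the ⊛-product of the same factors in reverse order.
-- Finally l ∈ F_σ iff n − l ∈ E_{ωσω}, so the blocks of T^⪰_{ωσω}(a_n,…,a₁) are the
-- blocks of U_σ(a₁,…,a_n), each reversed and in reverse order, and the signs add up to
-- (−1)^(Σ(m_i − 1) + q − 1) = (−1)^(n−1).
module Submission where

open import Defs
open import Level using (Level)
open import Function using (_∘_)
open import Function.Bundles using (mk⇔)
open import Data.Bool using (Bool; true; false; if_then_else_)
open import Data.Nat using (ℕ; zero; suc; pred; _+_; _∸_; _<_; _≤_; s≤s)
open import Data.Nat.Properties using (+-suc; +-identityʳ; +-∸-assoc; ∸-monoʳ-<; ∸-monoʳ-≤)
open import Data.Fin using (Fin; toℕ; opposite; inject₁; fromℕ)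
  renaming (zero to fzero; suc to fsuc; _<_ to _<ᶠ_; _≤_ to _≤ᶠ_)
open import Data.Fin.Properties using (opposite-prop; opposite-involutive; toℕ<n; toℕ-inject₁; toℕ-injective)
open import Data.Fin.Permutation using (Permutation′; _⟨$⟩ʳ_; _∘ₚ_)
open import Data.List using (List; []; _∷_; _∷ʳ_; map; concat; reverse; length; allFin; tabulate)
open import Data.List.Properties
  using (unfold-reverse; reverse-map; map-∘; map-cong; map-tabulate; foldl-∷ʳ; concat-map)
open import Data.List.Properties using (length-++; length-map; length-tabulate)
open import Data.List.Relation.Unary.Linked using (Linked; []; [-]; _∷_)
import Data.List.Relation.Unary.Linked as Linked
open import Relation.Nullary using (does)
open import Relation.Nullary.Decidable using (does-⇔)
open import Relation.Unary using (Pred; Decidable)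
open import Relation.Binary.PropositionalEquality
open import Algebra.Bundles using (CommutativeRing)
open import Algebra.Module.Bundles using (Module)

module _ {a} {A : Set a} where

  data Blocks : List (List A) → Set a where
    one  : ∀ {x xs} → Blocks ((x ∷ xs) ∷ [])
    more : ∀ {x xs y ys B} → Blocks ((y ∷ ys) ∷ B) → Blocks ((x ∷ xs) ∷ (y ∷ ys) ∷ B)

  consᵇ : (A → Bool) → A → List (List A) → List (List A)
  consᵇ c x S = if c x then (x ∷ []) ∷ S else consHead x S

  -- splitAfter with its recursion at top level, so that it can be reasoned about
  splitAfterᵇ : (A → Bool) → List A → List (List A)
  splitAfterᵇ c []           = []
  splitAfterᵇ c (x ∷ [])     = (x ∷ []) ∷ []
  splitAfterᵇ c (x ∷ y ∷ ys) = consᵇ c x (splitAfterᵇ c (y ∷ ys))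

  splitAfter≡splitAfterᵇ : ∀ {p} {P : Pred A p} (P? : Decidable P) xs →
                           splitAfter P? xs ≡ splitAfterᵇ (does ∘ P?) xs
  splitAfter≡splitAfterᵇ P? []           = refl
  splitAfter≡splitAfterᵇ P? (x ∷ [])     = refl
  splitAfter≡splitAfterᵇ P? (x ∷ y ∷ ys) =
    cong (consᵇ (does ∘ P?) x) (splitAfter≡splitAfterᵇ P? (y ∷ ys))

  concat-consᵇ : ∀ c x S → concat (consᵇ c x S) ≡ x ∷ concat S
  concat-consᵇ c x S with c x | S
  ... | true  | _     = refl
  ... | false | []    = refl
  ... | false | _ ∷ _ = refl

  concat-splitAfterᵇ : ∀ c xs → concat (splitAfterᵇ c xs) ≡ xs
  concat-splitAfterᵇ c []           = refl
  concat-splitAfterᵇ c (x ∷ [])     = refl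
  concat-splitAfterᵇ c (x ∷ y ∷ ys) =
    trans (concat-consᵇ c x _) (cong (x ∷_) (concat-splitAfterᵇ c (y ∷ ys)))

  Blocks-consᵇ : ∀ c x {S} → Blocks S → Blocks (consᵇ c x S)
  Blocks-consᵇ c x bs with c x | bs
  ... | true  | one     = more one
  ... | true  | more bs = more (more bs)
  ... | false | one     = one
  ... | false | more bs = more bs

  Blocks-splitAfterᵇ : ∀ c x xs → Blocks (splitAfterᵇ c (x ∷ xs))
  Blocks-splitAfterᵇ c x []       = one
  Blocks-splitAfterᵇ c x (y ∷ ys) = Blocks-consᵇ c x (Blocks-splitAfterᵇ c y ys)

  Blocks-splitAfter : ∀ {p} {P : Pred A p} (P? : Decidable P) x xs → Blocks (splitAfter P? (x ∷ xs))
  Blocks-splitAfter P? x xs =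
    subst Blocks (sym (splitAfter≡splitAfterᵇ P? (x ∷ xs))) (Blocks-splitAfterᵇ (does ∘ P?) x xs)

  concat-splitAfter : ∀ {p} {P : Pred A p} (P? : Decidable P) xs → concat (splitAfter P? xs) ≡ xs
  concat-splitAfter P? xs =
    trans (cong concat (splitAfter≡splitAfterᵇ P? xs)) (concat-splitAfterᵇ (does ∘ P?) xs)

  Blocks-splitAfterᵇ-∷ʳ : ∀ c xs y → Blocks (splitAfterᵇ c (xs ∷ʳ y))
  Blocks-splitAfterᵇ-∷ʳ c []       y = one
  Blocks-splitAfterᵇ-∷ʳ c (x ∷ xs) y = Blocks-splitAfterᵇ c x (xs ∷ʳ y)

  infixl 5 _∷ʳᴸ_

  _∷ʳᴸ_ : List (List A) → A → List (List A)
  []            ∷ʳᴸ x = (x ∷ []) ∷ []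
  (b ∷ [])      ∷ʳᴸ x = (b ∷ʳ x) ∷ []
  (b ∷ b′ ∷ bs) ∷ʳᴸ x = b ∷ ((b′ ∷ bs) ∷ʳᴸ x)

  consᵇ-∷ʳ : ∀ c w b {S} → Blocks S → consᵇ c w (S ∷ʳ b) ≡ consᵇ c w S ∷ʳ b
  consᵇ-∷ʳ c w b bs with c w | bs
  ... | true  | _      = refl
  ... | false | one    = refl
  ... | false | more _ = refl

  consᵇ-∷ʳᴸ : ∀ c w x {S} → Blocks S → consᵇ c w (S ∷ʳᴸ x) ≡ consᵇ c w S ∷ʳᴸ x
  consᵇ-∷ʳᴸ c w x bs with c w | bs
  ... | true  | one    = refl
  ... | true  | more _ = refl
  ... | false | one    = refl
  ... | false | more _ = refl

  splitAfterᵇ-∷-∷ʳ : ∀ c w ws y →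
                     splitAfterᵇ c (w ∷ ws ∷ʳ y) ≡ consᵇ c w (splitAfterᵇ c (ws ∷ʳ y))
  splitAfterᵇ-∷-∷ʳ c w []       y = refl
  splitAfterᵇ-∷-∷ʳ c w (_ ∷ _) y = refl

  splitAfterᵇ-∷ʳ : ∀ c zs y x → splitAfterᵇ c (zs ∷ʳ y ∷ʳ x) ≡
    (if c y then splitAfterᵇ c (zs ∷ʳ y) ∷ʳ (x ∷ []) else splitAfterᵇ c (zs ∷ʳ y) ∷ʳᴸ x)
  splitAfterᵇ-∷ʳ c [] y x with c y
  ... | true  = refl
  ... | false = refl
  splitAfterᵇ-∷ʳ c (w ∷ ws) y x
    rewrite splitAfterᵇ-∷-∷ʳ c w (ws ∷ʳ y) x | splitAfterᵇ-∷ʳ c ws y x | splitAfterᵇ-∷-∷ʳ c w ws y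
    with c y
  ... | true  = consᵇ-∷ʳ c w (x ∷ []) (Blocks-splitAfterᵇ-∷ʳ c ws y)
  ... | false = consᵇ-∷ʳᴸ c w x (Blocks-splitAfterᵇ-∷ʳ c ws y)

  reverse-∷-∷ : ∀ (x y : A) ys → reverse (x ∷ y ∷ ys) ≡ reverse ys ∷ʳ y ∷ʳ x
  reverse-∷-∷ x y ys = trans (unfold-reverse x (y ∷ ys)) (cong (_∷ʳ x) (unfold-reverse y ys))

  reverseBlocks : List (List A) → List (List A)
  reverseBlocks S = reverse (map reverse S)

  ∷ʳ-∷ʳᴸ : ∀ B b (x : A) → (B ∷ʳ b) ∷ʳᴸ x ≡ B ∷ʳ (b ∷ʳ x)
  ∷ʳ-∷ʳᴸ []            b x = refl
  ∷ʳ-∷ʳᴸ (b′ ∷ [])     b x = refl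
  ∷ʳ-∷ʳᴸ (b′ ∷ b″ ∷ B) b x = cong (b′ ∷_) (∷ʳ-∷ʳᴸ (b″ ∷ B) b x)

  reverseBlocks-consHead : ∀ x b S → reverseBlocks (consHead x (b ∷ S)) ≡ reverseBlocks (b ∷ S) ∷ʳᴸ x
  reverseBlocks-consHead x b S = begin
    reverse (reverse (x ∷ b) ∷ map reverse S)
      ≡⟨ unfold-reverse _ (map reverse S) ⟩
    reverseBlocks S ∷ʳ reverse (x ∷ b)
      ≡⟨ cong (reverseBlocks S ∷ʳ_) (unfold-reverse x b) ⟩
    reverseBlocks S ∷ʳ (reverse b ∷ʳ x)
      ≡⟨ ∷ʳ-∷ʳᴸ (reverseBlocks S) (reverse b) x ⟨
    (reverseBlocks S ∷ʳ reverse b) ∷ʳᴸ x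
      ≡⟨ cong (_∷ʳᴸ x) (unfold-reverse (reverse b) (map reverse S)) ⟨
    reverseBlocks (b ∷ S) ∷ʳᴸ x ∎
    where open ≡-Reasoning

  reverseBlocks-consᵇ : ∀ c x {S} → Blocks S → reverseBlocks (consᵇ c x S) ≡
    (if c x then reverseBlocks S ∷ʳ (x ∷ []) else reverseBlocks S ∷ʳᴸ x)
  reverseBlocks-consᵇ c x {S} bs with c x | bs
  ... | true  | _                          = unfold-reverse (x ∷ []) (map reverse S)
  ... | false | one {y} {ys}                 = reverseBlocks-consHead x (y ∷ ys) []
  ... | false | more {y} {ys} {z} {zs} {B} _ = reverseBlocks-consHead x (y ∷ ys) ((z ∷ zs) ∷ B)

  splitAfterᵇ-reverse : ∀ c d {xs} → Linked (λ x y → d y ≡ c x) xs →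
                        splitAfterᵇ d (reverse xs) ≡ reverseBlocks (splitAfterᵇ c xs)
  splitAfterᵇ-reverse c d []                  = refl
  splitAfterᵇ-reverse c d [-]                 = refl
  splitAfterᵇ-reverse c d {x ∷ y ∷ ys} (dy≡cx ∷ linked) = begin
    splitAfterᵇ d (reverse (x ∷ y ∷ ys))
      ≡⟨ cong (splitAfterᵇ d) (reverse-∷-∷ x y ys) ⟩
    splitAfterᵇ d (reverse ys ∷ʳ y ∷ʳ x)
      ≡⟨ splitAfterᵇ-∷ʳ d (reverse ys) y x ⟩
    (if d y then S ∷ʳ (x ∷ []) else S ∷ʳᴸ x)
      ≡⟨ cong₂ (λ b S → if b then S ∷ʳ (x ∷ []) else S ∷ʳᴸ x) dy≡cx S≡ ⟩
    (if c x then reverseBlocks T ∷ʳ (x ∷ []) else reverseBlocks T ∷ʳᴸ x)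
      ≡⟨ reverseBlocks-consᵇ c x (Blocks-splitAfterᵇ c y ys) ⟨
    reverseBlocks (splitAfterᵇ c (x ∷ y ∷ ys)) ∎
    where
    open ≡-Reasoning
    S = splitAfterᵇ d (reverse ys ∷ʳ y)
    T = splitAfterᵇ c (y ∷ ys)
    S≡ : S ≡ reverseBlocks T
    S≡ = trans (cong (splitAfterᵇ d) (sym (unfold-reverse y ys))) (splitAfterᵇ-reverse c d linked)

module _ {a b} {A : Set a} {B : Set b} where

  consᵇ-map : ∀ c (f : A → B) x S → consᵇ c (f x) (map (map f) S) ≡ map (map f) (consᵇ (c ∘ f) x S)
  consᵇ-map c f x S with c (f x) | S
  ... | true  | _     = refl
  ... | false | []    = refl
  ... | false | _ ∷ _ = refl

  splitAfterᵇ-map : ∀ c (f : A → B) xs → splitAfterᵇ c (map f xs) ≡ map (map f) (splitAfterᵇ (c ∘ f) xs)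
  splitAfterᵇ-map c f []           = refl
  splitAfterᵇ-map c f (x ∷ [])     = refl
  splitAfterᵇ-map c f (x ∷ y ∷ ys) =
    trans (cong (consᵇ c (f x)) (splitAfterᵇ-map c f (y ∷ ys))) (consᵇ-map c f x _)

  Blocks-map : ∀ (f : A → B) {S} → Blocks S → Blocks (map (map f) S)
  Blocks-map f one       = one
  Blocks-map f (more bs) = more (Blocks-map f bs)

  length-concat-map-splitAfter : ∀ {p} {P : Pred A p} (P? : Decidable P) (f : A → B) xs →
                                 length (concat (map (map f) (splitAfter P? xs))) ≡ length xs
  length-concat-map-splitAfter P? f xs = begin
    length (concat (map (map f) S))   ≡⟨ cong length (concat-map S) ⟩
    length (map f (concat S))         ≡⟨ length-map f (concat S) ⟩
    length (concat S)                 ≡⟨ cong length (concat-splitAfter P? xs) ⟩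
    length xs                         ∎
    where
    open ≡-Reasoning
    S = splitAfter P? xs

  map-reverseBlocks : ∀ (f : A → B) S → map (map f) (reverseBlocks S) ≡ reverseBlocks (map (map f) S)
  map-reverseBlocks f S = begin
    map (map f) (reverse (map reverse S))   ≡⟨ reverse-map (map f) (map reverse S) ⟩
    reverse (map (map f) (map reverse S))   ≡⟨ cong reverse (map-∘ S) ⟨
    reverse (map (map f ∘ reverse) S)       ≡⟨ cong reverse (map-cong (reverse-map f) S) ⟩
    reverse (map (reverse ∘ map f) S)       ≡⟨ cong reverse (map-∘ S) ⟩
    reverseBlocks (map (map f) S)           ∎
    where open ≡-Reasoning

module _ {a ℓ} {A : Set a} {R : A → A → Set ℓ} where

  Linked-tabulate : ∀ {n} (f : Fin (suc n) → A) → (∀ i → R (f (inject₁ i)) (f (fsuc i))) →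
                    Linked R (tabulate f)
  Linked-tabulate {zero}  f Rf = [-]
  Linked-tabulate {suc n} f Rf = Rf fzero ∷ Linked-tabulate (f ∘ fsuc) (Rf ∘ fsuc)

module _ {a} {A : Set a} where

  tabulate-∷ʳ : ∀ {n} (f : Fin (suc n) → A) → tabulate f ≡ tabulate (f ∘ inject₁) ∷ʳ f (fromℕ n)
  tabulate-∷ʳ {zero}  f = refl
  tabulate-∷ʳ {suc n} f = cong (f fzero ∷_) (tabulate-∷ʳ (f ∘ fsuc))

  reverse-tabulate-opposite : ∀ {n} (f : Fin n → A) → reverse (tabulate (f ∘ opposite)) ≡ tabulate f
  reverse-tabulate-opposite {zero}  f = refl
  reverse-tabulate-opposite {suc n} f = begin
    reverse (f (fromℕ n) ∷ tabulate (f ∘ inject₁ ∘ opposite))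
      ≡⟨ unfold-reverse (f (fromℕ n)) (tabulate (f ∘ inject₁ ∘ opposite)) ⟩
    reverse (tabulate (f ∘ inject₁ ∘ opposite)) ∷ʳ f (fromℕ n)
      ≡⟨ cong (_∷ʳ f (fromℕ n)) (reverse-tabulate-opposite (f ∘ inject₁)) ⟩
    tabulate (f ∘ inject₁) ∷ʳ f (fromℕ n)
      ≡⟨ tabulate-∷ʳ f ⟨
    tabulate f ∎
    where open ≡-Reasoning

map-opposite-reverse-allFin : ∀ n → map opposite (reverse (allFin n)) ≡ allFin n
map-opposite-reverse-allFin n = begin
  map opposite (reverse (allFin n))  ≡⟨ reverse-map opposite (allFin n) ⟩
  reverse (map opposite (allFin n))  ≡⟨ cong reverse (map-tabulate (λ i → i) opposite) ⟩
  reverse (tabulate opposite)        ≡⟨ reverse-tabulate-opposite (λ i → i) ⟩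
  allFin n                           ∎
  where open ≡-Reasoning

Adjacent : ∀ {n} → Fin n → Fin n → Set
Adjacent p q = toℕ q ≡ suc (toℕ p)

Linked-Adjacent-allFin : ∀ n → Linked Adjacent (allFin n)
Linked-Adjacent-allFin zero    = []
Linked-Adjacent-allFin (suc n) = Linked-tabulate (λ i → i) (λ i → cong suc (sym (toℕ-inject₁ i)))

module _ {n : ℕ} where

  opposite-< : ∀ {i j : Fin n} → i <ᶠ j → opposite j <ᶠ opposite i
  opposite-< {i} {j} i<j = subst₂ _<_ (sym (opposite-prop j)) (sym (opposite-prop i))
                                  (∸-monoʳ-< (s≤s i<j) (toℕ<n j))

  opposite-≤ : ∀ {i j : Fin n} → i ≤ᶠ j → opposite j ≤ᶠ opposite i
  opposite-≤ {i} {j} i≤j = subst₂ _≤_ (sym (opposite-prop j)) (sym (opposite-prop i))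
                                  (∸-monoʳ-≤ n (s≤s i≤j))

  opposite-<-reflects : ∀ {i j : Fin n} → opposite i <ᶠ opposite j → j <ᶠ i
  opposite-<-reflects {i} {j} o<o =
    subst₂ _<ᶠ_ (opposite-involutive j) (opposite-involutive i) (opposite-< o<o)

  ≤-opposite : ∀ {i j : Fin n} → i ≤ᶠ opposite j → j ≤ᶠ opposite i
  ≤-opposite {i} {j} i≤o = subst (_≤ᶠ opposite i) (opposite-involutive j) (opposite-≤ i≤o)

  opposite-Adjacent : ∀ {i j : Fin n} → Adjacent i j → Adjacent (opposite j) (opposite i)
  opposite-Adjacent {i} {j} adj = begin
    toℕ (opposite i)                ≡⟨ opposite-prop i ⟩
    suc n ∸ suc (suc (toℕ i))       ≡⟨ +-∸-assoc 1 (subst (_≤ n) (cong suc adj) (toℕ<n j)) ⟩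
    suc (n ∸ suc (suc (toℕ i)))     ≡⟨ cong (λ m → suc (n ∸ suc m)) adj ⟨
    suc (n ∸ suc (toℕ j))           ≡⟨ cong suc (opposite-prop j) ⟨
    suc (toℕ (opposite j))          ∎
    where open ≡-Reasoning

module _ {a b c} {A : Set a} {B : Set b} {C : Set c} where

  map-map-fusion : ∀ {f : B → C} {g : A → B} {h : A → C} → (∀ x → f (g x) ≡ h x) →
                   ∀ S → map (map f) (map (map g) S) ≡ map (map h) S
  map-map-fusion f∘g≗h S =
    trans (sym (map-∘ S)) (map-cong (λ b → trans (sym (map-∘ b)) (map-cong f∘g≗h b)) S)

module _ {n} (σ : Permutation′ n) where

  private
    τ : Permutation′ n
    τ = ω ∘ₚ σ ∘ₚ ω

  ωσω-opposite : ∀ i → τ ⟨$⟩ʳ opposite i ≡ opposite (σ ⟨$⟩ʳ i)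
  ωσω-opposite i = cong (λ j → opposite (σ ⟨$⟩ʳ j)) (opposite-involutive i)

  FCut⇒ECut : ∀ {p q} → Adjacent p q → FCut σ p → ECut τ (opposite q)
  FCut⇒ECut {p} {q} adj cut q′ adj′ j j≤q̅
    with refl ← toℕ-injective {i = q′} (trans adj′ (sym (opposite-Adjacent adj))) =
    subst (τ ⟨$⟩ʳ j <ᶠ_) (sym (ωσω-opposite p)) (opposite-< (cut (opposite j) p<j̅))
    where
    p<j̅ : p <ᶠ opposite j
    p<j̅ = subst (_≤ toℕ (opposite j)) adj (≤-opposite j≤q̅)

  ECut⇒FCut : ∀ {p q} → Adjacent p q → ECut τ (opposite q) → FCut σ p
  ECut⇒FCut {p} {q} adj cut r p<r =
    opposite-<-reflects (subst₂ _<ᶠ_ (ωσω-opposite r) (ωσω-opposite p)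
      (cut (opposite p) (opposite-Adjacent adj) (opposite r) (opposite-≤ q≤r)))
    where
    q≤r : q ≤ᶠ r
    q≤r = subst (_≤ toℕ r) (sym adj) p<r

  splitAfter-ECut : splitAfter (ECut? τ) (allFin n) ≡
                    map (map opposite) (reverseBlocks (splitAfter (FCut? σ) (allFin n)))
  splitAfter-ECut = begin
    splitAfter (ECut? τ) (allFin n)
      ≡⟨ splitAfter≡splitAfterᵇ (ECut? τ) (allFin n) ⟩
    splitAfterᵇ cutE (allFin n)
      ≡⟨ cong (splitAfterᵇ cutE) (map-opposite-reverse-allFin n) ⟨
    splitAfterᵇ cutE (map opposite (reverse (allFin n)))
      ≡⟨ splitAfterᵇ-map cutE opposite (reverse (allFin n)) ⟩
    map (map opposite) (splitAfterᵇ (cutE ∘ opposite) (reverse (allFin n)))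
      ≡⟨ cong (map (map opposite)) (splitAfterᵇ-reverse cutF (cutE ∘ opposite) linked) ⟩
    map (map opposite) (reverseBlocks (splitAfterᵇ cutF (allFin n)))
      ≡⟨ cong (map (map opposite) ∘ reverseBlocks) (splitAfter≡splitAfterᵇ (FCut? σ) (allFin n)) ⟨
    map (map opposite) (reverseBlocks (splitAfter (FCut? σ) (allFin n))) ∎
    where
    open ≡-Reasoning
    cutE cutF : Fin n → Bool
    cutE = does ∘ ECut? τ
    cutF = does ∘ FCut? σ
    linked : Linked (λ p q → cutE (opposite q) ≡ cutF p) (allFin n)
    linked = Linked.map (λ {p} {q} adj → does-⇔ (mk⇔ (ECut⇒FCut adj) (FCut⇒ECut adj))
                                                (ECut? τ (opposite q)) (FCut? σ p))
                        (Linked-Adjacent-allFin n)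

  blocks-ωσω : ∀ {x} {X : Set x} (a : Fin n → X) →
    map (map (λ p → a (opposite (τ ⟨$⟩ʳ p)))) (splitAfter (ECut? τ) (allFin n)) ≡
    reverseBlocks (map (map (λ p → a (σ ⟨$⟩ʳ p))) (splitAfter (FCut? σ) (allFin n)))
  blocks-ωσω a = begin
    map (map w) (splitAfter (ECut? τ) (allFin n))
      ≡⟨ cong (map (map w)) splitAfter-ECut ⟩
    map (map w) (map (map opposite) (reverseBlocks S))
      ≡⟨ map-map-fusion w∘opposite≗v (reverseBlocks S) ⟩
    map (map v) (reverseBlocks S)
      ≡⟨ map-reverseBlocks v S ⟩
    reverseBlocks (map (map v) S) ∎
    where
    open ≡-Reasoning
    S = splitAfter (FCut? σ) (allFin n)
    v = λ p → a (σ ⟨$⟩ʳ p)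
    w = λ p → a (opposite (τ ⟨$⟩ʳ p))
    w∘opposite≗v : ∀ p → w (opposite p) ≡ v p
    w∘opposite≗v p = cong a (trans (cong opposite (ωσω-opposite p)) (opposite-involutive _))

module DendriformReversal {r ℓr m ℓm} {R : CommutativeRing r ℓr} {M : Module R m ℓm}
                          (D : Dendriform R M) where

  open CommutativeRing R using (1#; 0#; -_; _*_; -‿inverseˡ) renaming (_+_ to _+ᴿ_)
  open Module M
  open Dendriform D
  open import Algebra.Properties.AbelianGroup +ᴹ-abelianGroup using (⁻¹-∙-comm)
  open import Algebra.Module.Properties M using (-ᴹ-involutive; inverseˡ-uniqueᴹ)
  open import Relation.Binary.Reasoning.Setoid ≈ᴹ-setoid

  -1#*ₗ : ∀ x → (- 1#) *ₗ x ≈ᴹ -ᴹ x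
  -1#*ₗ x = inverseˡ-uniqueᴹ _ _ (begin
    (- 1#) *ₗ x +ᴹ x          ≈⟨ +ᴹ-congˡ (*ₗ-identityˡ x) ⟨
    (- 1#) *ₗ x +ᴹ 1# *ₗ x    ≈⟨ *ₗ-distribʳ x (- 1#) 1# ⟨
    ((- 1#) +ᴿ 1#) *ₗ x       ≈⟨ *ₗ-congʳ (-‿inverseˡ 1#) ⟩
    0# *ₗ x                   ≈⟨ *ₗ-zeroˡ x ⟩
    0ᴹ                        ∎)

  *ₗ-homo⇒-ᴹ-homo : (f : Carrierᴹ → Carrierᴹ) → (∀ {x y} → x ≈ᴹ y → f x ≈ᴹ f y) →
                    (∀ c x → f (c *ₗ x) ≈ᴹ c *ₗ f x) → ∀ x → f (-ᴹ x) ≈ᴹ -ᴹ f x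
  *ₗ-homo⇒-ᴹ-homo f f-cong f-*ₗ x = begin
    f (-ᴹ x)          ≈⟨ f-cong (-1#*ₗ x) ⟨
    f ((- 1#) *ₗ x)   ≈⟨ f-*ₗ (- 1#) x ⟩
    (- 1#) *ₗ f x     ≈⟨ -1#*ₗ (f x) ⟩
    -ᴹ f x            ∎

  ≺-negˡ : ∀ x y → (-ᴹ x) ≺ y ≈ᴹ -ᴹ (x ≺ y)
  ≺-negˡ x y = *ₗ-homo⇒-ᴹ-homo (_≺ y) (λ p → ≺-cong p ≈ᴹ-refl) (λ c u → ≺-*ˡ c u y) x

  ≺-negʳ : ∀ x y → x ≺ (-ᴹ y) ≈ᴹ -ᴹ (x ≺ y)
  ≺-negʳ x y = *ₗ-homo⇒-ᴹ-homo (x ≺_) (≺-cong ≈ᴹ-refl) (λ c u → ≺-*ʳ c x u) y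

  ≻-negˡ : ∀ x y → (-ᴹ x) ≻ y ≈ᴹ -ᴹ (x ≻ y)
  ≻-negˡ x y = *ₗ-homo⇒-ᴹ-homo (_≻ y) (λ p → ≻-cong p ≈ᴹ-refl) (λ c u → ≻-*ˡ c u y) x

  ≻-negʳ : ∀ x y → x ≻ (-ᴹ y) ≈ᴹ -ᴹ (x ≻ y)
  ≻-negʳ x y = *ₗ-homo⇒-ᴹ-homo (x ≻_) (≻-cong ≈ᴹ-refl) (λ c u → ≻-*ʳ c x u) y

  ⋆-cong : ∀ {x x′ y y′} → x ≈ᴹ x′ → y ≈ᴹ y′ → x ⋆ y ≈ᴹ x′ ⋆ y′
  ⋆-cong p q = +ᴹ-cong (≺-cong p q) (≻-cong p q)

  ⋆-negˡ : ∀ x y → (-ᴹ x) ⋆ y ≈ᴹ -ᴹ (x ⋆ y)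
  ⋆-negˡ x y = ≈ᴹ-trans (+ᴹ-cong (≺-negˡ x y) (≻-negˡ x y)) (⁻¹-∙-comm _ _)

  ⋆-negʳ : ∀ x y → x ⋆ (-ᴹ y) ≈ᴹ -ᴹ (x ⋆ y)
  ⋆-negʳ x y = ≈ᴹ-trans (+ᴹ-cong (≺-negʳ x y) (≻-negʳ x y)) (⁻¹-∙-comm _ _)

  ⋆-assoc : ∀ x y z → (x ⋆ y) ⋆ z ≈ᴹ x ⋆ (y ⋆ z)
  ⋆-assoc x y z = begin
    (x ⋆ y) ≺ z +ᴹ (x ⋆ y) ≻ z
      ≈⟨ +ᴹ-cong (≺-+ˡ (x ≺ y) (x ≻ y) z) (≈ᴹ-sym (dend₃ x y z)) ⟩
    (x ≺ y) ≺ z +ᴹ (x ≻ y) ≺ z +ᴹ x ≻ (y ≻ z)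
      ≈⟨ +ᴹ-congʳ (+ᴹ-cong (dend₁ x y z) (dend₂ x y z)) ⟩
    x ≺ (y ⋆ z) +ᴹ x ≻ (y ≺ z) +ᴹ x ≻ (y ≻ z)
      ≈⟨ +ᴹ-assoc _ _ _ ⟩
    x ≺ (y ⋆ z) +ᴹ (x ≻ (y ≺ z) +ᴹ x ≻ (y ≻ z))
      ≈⟨ +ᴹ-congˡ (≻-+ʳ x _ _) ⟨
    x ⋆ (y ⋆ z) ∎

  ⊛-congˡ : ∀ {x y y′} → y ≈ᴹ y′ → x ⊛ y ≈ᴹ x ⊛ y′
  ⊛-congˡ p = -ᴹ‿cong (⋆-cong p ≈ᴹ-refl)

  ⊛-assoc : ∀ x y z → (x ⊛ y) ⊛ z ≈ᴹ x ⊛ (y ⊛ z)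
  ⊛-assoc x y z = begin
    -ᴹ (z ⋆ -ᴹ (y ⋆ x))      ≈⟨ -ᴹ‿cong (⋆-negʳ z _) ⟩
    -ᴹ -ᴹ (z ⋆ (y ⋆ x))      ≈⟨ -ᴹ‿cong (-ᴹ‿cong (⋆-assoc z y x)) ⟨
    -ᴹ -ᴹ ((z ⋆ y) ⋆ x)      ≈⟨ -ᴹ‿cong (⋆-negˡ (z ⋆ y) x) ⟨
    -ᴹ ((-ᴹ (z ⋆ y)) ⋆ x)    ∎

  ⋆≈-⊛ : ∀ x y → x ⋆ y ≈ᴹ -ᴹ (y ⊛ x)
  ⋆≈-⊛ x y = ≈ᴹ-sym (-ᴹ-involutive (x ⋆ y))

  ▷-negˡ : ∀ x y → (-ᴹ x) ▷ y ≈ᴹ -ᴹ (x ▷ y)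
  ▷-negˡ x y = ≈ᴹ-trans (+ᴹ-cong (≻-negˡ x y) (-ᴹ‿cong (≺-negʳ y x))) (⁻¹-∙-comm _ _)

  ◁-congˡ : ∀ {x y y′} → y ≈ᴹ y′ → x ◁ y ≈ᴹ x ◁ y′
  ◁-congˡ p = +ᴹ-cong (≺-cong ≈ᴹ-refl p) (-ᴹ‿cong (≻-cong p ≈ᴹ-refl))

  ◁≈-▷ : ∀ x y → x ◁ y ≈ᴹ -ᴹ (y ▷ x)
  ◁≈-▷ x y = begin
    x ≺ y +ᴹ -ᴹ (y ≻ x)          ≈⟨ +ᴹ-comm _ _ ⟩
    -ᴹ (y ≻ x) +ᴹ x ≺ y          ≈⟨ +ᴹ-congˡ (-ᴹ-involutive (x ≺ y)) ⟨
    -ᴹ (y ≻ x) +ᴹ -ᴹ -ᴹ (x ≺ y)  ≈⟨ ⁻¹-∙-comm _ _ ⟩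
    -ᴹ (y ▷ x)                   ∎

  neg^ : ℕ → Carrierᴹ → Carrierᴹ
  neg^ zero    x = x
  neg^ (suc k) x = -ᴹ neg^ k x

  neg^-cong : ∀ k {x y} → x ≈ᴹ y → neg^ k x ≈ᴹ neg^ k y
  neg^-cong zero    p = p
  neg^-cong (suc k) p = -ᴹ‿cong (neg^-cong k p)

  neg^-negate : ∀ k x → neg^ k (-ᴹ x) ≈ᴹ neg^ (suc k) x
  neg^-negate zero    x = ≈ᴹ-refl
  neg^-negate (suc k) x = -ᴹ‿cong (neg^-negate k x)

  neg^-▷ : ∀ k x y → neg^ k x ▷ y ≈ᴹ neg^ k (x ▷ y)
  neg^-▷ zero    x y = ≈ᴹ-refl
  neg^-▷ (suc k) x y = ≈ᴹ-trans (▷-negˡ _ y) (-ᴹ‿cong (neg^-▷ k x y))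

  neg^-⋆ : ∀ k k′ x y → neg^ k x ⋆ neg^ k′ y ≈ᴹ neg^ (k + k′) (x ⋆ y)
  neg^-⋆ zero    zero     x y = ≈ᴹ-refl
  neg^-⋆ zero    (suc k′) x y = ≈ᴹ-trans (⋆-negʳ x _) (-ᴹ‿cong (neg^-⋆ zero k′ x y))
  neg^-⋆ (suc k) k′       x y = ≈ᴹ-trans (⋆-negˡ _ _) (-ᴹ‿cong (neg^-⋆ k k′ x y))

  minusOne^-*ₗ : ∀ k x → minusOne^ R k *ₗ x ≈ᴹ neg^ k x
  minusOne^-*ₗ zero    x = *ₗ-identityˡ x
  minusOne^-*ₗ (suc k) x = begin
    ((- 1#) * minusOne^ R k) *ₗ x     ≈⟨ *ₗ-assoc _ _ x ⟩
    (- 1#) *ₗ (minusOne^ R k *ₗ x)    ≈⟨ -1#*ₗ _ ⟩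
    -ᴹ (minusOne^ R k *ₗ x)           ≈⟨ -ᴹ‿cong (minusOne^-*ₗ k x) ⟩
    -ᴹ neg^ k x                       ∎

  ℓ⁽⁾-∷ʳ : ∀ xs y z → ℓ⁽⁾ (xs ∷ʳ y ∷ʳ z) ≡ ℓ⁽⁾ (xs ∷ʳ y) ▷ z
  ℓ⁽⁾-∷ʳ []       y z = refl
  ℓ⁽⁾-∷ʳ (x ∷ xs) y z = foldl-∷ʳ _▷_ x z (xs ∷ʳ y)

  ℓ⁽⁾-reverse-∷ : ∀ x y ys → ℓ⁽⁾ (reverse (x ∷ y ∷ ys)) ≡ ℓ⁽⁾ (reverse (y ∷ ys)) ▷ x
  ℓ⁽⁾-reverse-∷ x y ys = trans (cong ℓ⁽⁾ (reverse-∷-∷ x y ys))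
    (trans (ℓ⁽⁾-∷ʳ (reverse ys) y x) (cong (λ zs → ℓ⁽⁾ zs ▷ x) (sym (unfold-reverse y ys))))

  r⁽⁾≈ℓ⁽⁾-reverse : ∀ x xs → r⁽⁾ (x ∷ xs) ≈ᴹ neg^ (length xs) (ℓ⁽⁾ (reverse (x ∷ xs)))
  r⁽⁾≈ℓ⁽⁾-reverse x []       = ≈ᴹ-refl
  r⁽⁾≈ℓ⁽⁾-reverse x (y ∷ ys) = begin
    x ◁ r⁽⁾ (y ∷ ys)                   ≈⟨ ◁-congˡ (r⁽⁾≈ℓ⁽⁾-reverse y ys) ⟩
    x ◁ neg^ k W                       ≈⟨ ◁≈-▷ x _ ⟩
    -ᴹ (neg^ k W ▷ x)                  ≈⟨ -ᴹ‿cong (neg^-▷ k W x) ⟩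
    -ᴹ neg^ k (W ▷ x)                  ≡⟨ cong (-ᴹ_ ∘ neg^ k) (ℓ⁽⁾-reverse-∷ x y ys) ⟨
    -ᴹ neg^ k (ℓ⁽⁾ (reverse (x ∷ y ∷ ys))) ∎
    where
    k = length ys
    W = ℓ⁽⁾ (reverse (y ∷ ys))

  prod-∷ʳ : ∀ {_∙_ : Carrierᴹ → Carrierᴹ → Carrierᴹ} →
            (∀ {x y y′} → y ≈ᴹ y′ → (x ∙ y) ≈ᴹ (x ∙ y′)) →
            (∀ x y z → ((x ∙ y) ∙ z) ≈ᴹ (x ∙ (y ∙ z))) →
            ∀ xs y z → prod _∙_ (xs ∷ʳ y ∷ʳ z) ≈ᴹ (prod _∙_ (xs ∷ʳ y) ∙ z)
  prod-∷ʳ ∙-congˡ ∙-assoc []            y z = ≈ᴹ-refl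
  prod-∷ʳ ∙-congˡ ∙-assoc (x ∷ [])      y z = ≈ᴹ-sym (∙-assoc x y z)
  prod-∷ʳ ∙-congˡ ∙-assoc (x ∷ x′ ∷ xs) y z =
    ≈ᴹ-trans (∙-congˡ (prod-∷ʳ ∙-congˡ ∙-assoc (x′ ∷ xs) y z)) (≈ᴹ-sym (∙-assoc x _ z))

  prod-⊛-reverse-∷ : ∀ x y ys → prod _⊛_ (reverse (x ∷ y ∷ ys)) ≈ᴹ prod _⊛_ (reverse (y ∷ ys)) ⊛ x
  prod-⊛-reverse-∷ x y ys = begin
    prod _⊛_ (reverse (x ∷ y ∷ ys))     ≡⟨ cong (prod _⊛_) (reverse-∷-∷ x y ys) ⟩
    prod _⊛_ (reverse ys ∷ʳ y ∷ʳ x)     ≈⟨ prod-∷ʳ ⊛-congˡ ⊛-assoc (reverse ys) y x ⟩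
    prod _⊛_ (reverse ys ∷ʳ y) ⊛ x      ≡⟨ cong (λ zs → prod _⊛_ zs ⊛ x) (unfold-reverse y ys) ⟨
    prod _⊛_ (reverse (y ∷ ys)) ⊛ x     ∎

  prod-⋆-r⁽⁾≈prod-⊛-ℓ⁽⁾-reverse : ∀ {B} → Blocks B → prod _⋆_ (map r⁽⁾ B) ≈ᴹ
               neg^ (pred (length (concat B))) (prod _⊛_ (reverse (map ℓ⁽⁾ (map reverse B))))
  prod-⋆-r⁽⁾≈prod-⊛-ℓ⁽⁾-reverse (one {x} {xs}) = ≈ᴹ-trans (r⁽⁾≈ℓ⁽⁾-reverse x xs)
    (≈ᴹ-reflexive (cong (λ k → neg^ k (ℓ⁽⁾ (reverse (x ∷ xs))))
                        (sym (trans (length-++ xs) (+-identityʳ _)))))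
  prod-⋆-r⁽⁾≈prod-⊛-ℓ⁽⁾-reverse (more {x} {xs} {y} {ys} {B′} bs) = begin
    r⁽⁾ (x ∷ xs) ⋆ prod _⋆_ (map r⁽⁾ B)
      ≈⟨ ⋆-cong (r⁽⁾≈ℓ⁽⁾-reverse x xs) (prod-⋆-r⁽⁾≈prod-⊛-ℓ⁽⁾-reverse bs) ⟩
    neg^ k G ⋆ neg^ k′ T
      ≈⟨ neg^-⋆ k k′ G T ⟩
    neg^ (k + k′) (G ⋆ T)
      ≈⟨ neg^-cong (k + k′) (⋆≈-⊛ G T) ⟩
    neg^ (k + k′) (-ᴹ (T ⊛ G))
      ≈⟨ neg^-negate (k + k′) (T ⊛ G) ⟩
    neg^ (suc (k + k′)) (T ⊛ G)
      ≡⟨ cong (λ e → neg^ e (T ⊛ G)) length-concat ⟨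
    neg^ e (T ⊛ G)
      ≈⟨ neg^-cong e (prod-⊛-reverse-∷ G _ (map ℓ⁽⁾ (map reverse B′))) ⟨
    neg^ e (prod _⊛_ (reverse (map ℓ⁽⁾ (map reverse ((x ∷ xs) ∷ B))))) ∎
    where
    B = (y ∷ ys) ∷ B′
    k = length xs
    k′ = pred (length (concat B))
    e = pred (length (concat ((x ∷ xs) ∷ B)))
    G = ℓ⁽⁾ (reverse (x ∷ xs))
    T = prod _⊛_ (reverse (map ℓ⁽⁾ (map reverse B)))
    length-concat : e ≡ suc (k + k′)
    length-concat = trans (length-++ xs) (+-suc k k′)

lemma6p2 : ∀ {r ℓr m ℓm : Level} (R : CommutativeRing r ℓr) → IsField R →
           (M : Module R m ℓm) (D : Dendriform R M) (k : ℕ)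
           (a : Fin (suc k) → Module.Carrierᴹ M) (σ : Permutation′ (suc k)) →
           Module._≈ᴹ_ M (U D σ a)
             (Module._*ₗ_ M (minusOne^ R k) (T⪰ D (ω ∘ₚ σ ∘ₚ ω) (λ i → a (opposite i))))
lemma6p2 R _ M D k a σ = begin
  U D σ a
    ≡⟨ cong (prod _⋆_) (map-∘ S) ⟩
  prod _⋆_ (map r⁽⁾ V)
    ≈⟨ prod-⋆-r⁽⁾≈prod-⊛-ℓ⁽⁾-reverse (Blocks-map v (Blocks-splitAfter (FCut? σ) fzero (tabulate fsuc))) ⟩
  neg^ (pred (length (concat V))) (prod _⊛_ (reverse (map ℓ⁽⁾ (map reverse V))))
    ≡⟨ cong₂ (λ e W → neg^ e (prod _⊛_ W)) length-concat-V (sym (reverse-map ℓ⁽⁾ (map reverse V))) ⟩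
  neg^ k (prod _⊛_ (map ℓ⁽⁾ (reverseBlocks V)))
    ≡⟨ cong (neg^ k ∘ prod _⊛_ ∘ map ℓ⁽⁾) (blocks-ωσω σ a) ⟨
  neg^ k (prod _⊛_ (map ℓ⁽⁾ (map (map w) E)))
    ≡⟨ cong (neg^ k ∘ prod _⊛_) (map-∘ E) ⟨
  neg^ k (T⪰ D (ω ∘ₚ σ ∘ₚ ω) (λ i → a (opposite i)))
    ≈⟨ minusOne^-*ₗ k _ ⟨
  minusOne^ R k *ₗ T⪰ D (ω ∘ₚ σ ∘ₚ ω) (λ i → a (opposite i)) ∎
  where
  open Module M
  open Dendriform D
  open DendriformReversal D
  open import Relation.Binary.Reasoning.Setoid ≈ᴹ-setoid
  S = splitAfter (FCut? σ) (allFin (suc k))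
  E = splitAfter (ECut? (ω ∘ₚ σ ∘ₚ ω)) (allFin (suc k))
  v = λ p → a (σ ⟨$⟩ʳ p)
  w = λ p → a (opposite ((ω ∘ₚ σ ∘ₚ ω) ⟨$⟩ʳ p))
  V = map (map v) S
  length-concat-V : pred (length (concat V)) ≡ k
  length-concat-V = cong pred (trans (length-concat-map-splitAfter (FCut? σ) v (allFin (suc k)))
                                     (length-tabulate (λ i → i)))
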